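{- Let $G$ be a connected graph with vertex set $\{1,\dots,n\}$, $n\ge 2$, let $\Phi=(F_1,\dots,F_n)$ be an $n$-tuple of pairwise disjoint graphs, and let $G[\Phi]$ be the generalized lexicographic product. Let $D$ be a minimum dominating set of $G[\Phi]$ such that $|V(F_i)|\ge 2$ and $|D\cap V(F_i)|\ne 1$ for all $i\in[n]$. Let $F_{i_1},\dots,F_{i_s}$ be all the $F_i$ with $D\cap V(F_i)\neq\emptyset$. Then $|D\cap V(F_{i_r})|=2$ for all $r\in[s]$, $\{i_1,\dots,i_s\}$ is an efficient dominating set of $G$, and $2\gamma(G)=\gamma_t(G)=\gamma(G[\Phi])=\gamma_r(G[\Phi])=\gamma_t(G[\Phi])=\gamma_{tr}(G[\Phi])=\gamma^{oc}(G[\Phi])=\gamma_t^{oc}(G[\Phi])=\gamma_p(G[\Phi])$.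
   Context: All graphs are finite, simple and undirected; $[n]=\{1,\dots,n\}$. The generalized lexicographic product $G[\Phi]$ is the graph with vertex set $\bigcup_{i=1}^n V(F_i)$ in which each $F_i$ is an induced subgraph, and for $x\in V(F_i)$, $y\in V(F_j)$ with $i\neq j$, $xy$ is an edge iff $ij\in E(G)$. For a graph $H$ and $S\subseteq V(H)$: $S$ is dominating if every vertex outside $S$ has a neighbor in $S$; efficient dominating if every vertex of $H$ is dominated (i.e. equals or is adjacent to) exactly one vertex of $S$; total dominating if every vertex of $H$ has a neighbor in $S$; a dominating set $S$ is restrained if every vertex outside $S$ has a neighbor outside $S$, outer-connected if the subgraph induced by $V(H)\setminus S$ is connected, and paired if the subgraph induced by $S$ has a perfect matching. $\gamma,\gamma_t,\gamma_r,\gamma_{tr},\gamma^{oc},\gamma_t^{oc},\gamma_p$ denote the minimum cardinalities of, respectively, dominating, total dominating, restrained dominating, total restrained dominating (total and restrained), outer-connected dominating, total outer-connected dominating (total and outer-connected), and paired dominating sets. -}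

module Defs where

open import Data.Nat using (ℕ; _≤_; _<?_; _*_)
open import Data.Fin using (Fin; _≟_)
open import Data.Product using (Σ; ∃; ∃-syntax; _×_; _,_; proj₁)
open import Data.Sum using (_⊎_)
open import Data.Unit using (⊤)
open import Data.List using (List; length; filter; allFin)
open import Data.List.Membership.Propositional using (_∈_; _∉_)
open import Data.List.Relation.Unary.Unique.Propositional using (Unique)
open import Relation.Nullary using (¬_)
open import Relation.Binary.PropositionalEquality using (_≡_; _≢_)

-- A finite simple graph on a vertex type V (all vertex types used below are finite:
-- Fin n, Fin (m i), and Σ (Fin n) (Fin ∘ m)).  Adjacency is a symmetric irreflexive relation.
record Graph (V : Set) : Set₁ where
  field
    Adj    : V → V → Set
    sym    : ∀ {u v} → Adj u v → Adj v u
    irrefl : ∀ {v} → ¬ Adj v v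
open Graph public

-- A vertex subset is a duplicate-free list of vertices (Unique is required wherever
-- a set is quantified); its cardinality is the length.

module _ {V : Set} (H : Graph V) where

  data Reach (P : V → Set) : V → V → Set where
    here : ∀ {v} → P v → Reach P v v
    step : ∀ {u w v} → P u → Adj H u w → Reach P w v → Reach P u v

  Connected : Set
  Connected = ∀ u v → Reach (λ _ → ⊤) u v

  Dominating : List V → Set
  Dominating S = ∀ v → v ∉ S → ∃[ u ] (u ∈ S × Adj H u v)

  Dominates : V → V → Set
  Dominates u v = u ≡ v ⊎ Adj H u v

  EfficientDominating : List V → Set
  EfficientDominating S =
    ∀ v → (∃[ u ] (u ∈ S × Dominates u v))
        × (∀ u u′ → u ∈ S → u′ ∈ S → Dominates u v → Dominates u′ v → u ≡ u′)

  TotalDominating : List V → Set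
  TotalDominating S = ∀ v → ∃[ u ] (u ∈ S × Adj H u v)

  RestrainedCond : List V → Set
  RestrainedCond S = ∀ v → v ∉ S → ∃[ u ] (u ∉ S × Adj H u v)

  -- the subgraph induced by V ∖ S is connected (vacuous if V ∖ S is empty)
  OuterConnectedCond : List V → Set
  OuterConnectedCond S = ∀ u v → u ∉ S → v ∉ S → Reach (λ x → x ∉ S) u v

  -- the subgraph induced by S has a perfect matching, given as a
  -- fixed-point-free involution of S along edges
  PerfectMatchingOn : List V → Set
  PerfectMatchingOn S =
    Σ (V → V) λ p → ∀ v → v ∈ S → (p v ∈ S) × Adj H v (p v) × (p (p v) ≡ v)

  RestrainedDominating : List V → Set
  RestrainedDominating S = Dominating S × RestrainedCond S

  TotalRestrainedDominating : List V → Set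
  TotalRestrainedDominating S = TotalDominating S × RestrainedCond S

  OuterConnectedDominating : List V → Set
  OuterConnectedDominating S = Dominating S × OuterConnectedCond S

  TotalOuterConnectedDominating : List V → Set
  TotalOuterConnectedDominating S = TotalDominating S × OuterConnectedCond S

  PairedDominating : List V → Set
  PairedDominating S = Dominating S × PerfectMatchingOn S

  IsMinCard : (List V → Set) → ℕ → Set
  IsMinCard P k =
    (∃[ S ] (Unique S × P S × length S ≡ k))
    × (∀ S → Unique S → P S → k ≤ length S)

  MinimumDominating : List V → Set
  MinimumDominating S =
    Unique S × Dominating S × (∀ S′ → Unique S′ → Dominating S′ → length S ≤ length S′)

module _ {n : ℕ} (G : Graph (Fin n)) (m : Fin n → ℕ) (F : (i : Fin n) → Graph (Fin (m i))) where

  LexV : Set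
  LexV = Σ (Fin n) (λ i → Fin (m i))

  data LexAdj : LexV → LexV → Set where
    inside : ∀ {i a b} → Adj (F i) a b → LexAdj (i , a) (i , b)
    across : ∀ {i j a b} → i ≢ j → Adj G i j → LexAdj (i , a) (j , b)

  private
    lsym : ∀ {u v} → LexAdj u v → LexAdj v u
    lsym (inside e) = inside (sym (F _) e)
    lsym (across ne e) = across (λ eq → ne (Relation.Binary.PropositionalEquality.sym eq)) (sym G e)

    lirr : ∀ {v} → ¬ LexAdj v v
    lirr (inside e) = irrefl (F _) e
    lirr (across ne e) = ne Relation.Binary.PropositionalEquality.refl

  LexProduct : Graph LexV
  LexProduct = record { Adj = LexAdj ; sym = lsym ; irrefl = lirr }

  part : List LexV → Fin n → List LexV
  part D i = filter (λ x → proj₁ x ≟ i) D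

  support : List LexV → List (Fin n)
  support D = filter (λ i → 0 <? length (part D i)) (allFin n)

{-# OPTIONS --safe #-}
module Submission where

-- Let S be the support of D and σ a choice of one vertex in every F_i.  Lifting a total
-- dominating set T of G to {(i, σ i) : i ∈ T} dominates G[Φ], so |D| ≤ γ_t(G), and S
-- dominates G, so adding a neighbour ν i to every i ∈ S gives |D| ≤ 2|S|.  As no part of D
-- is a singleton, |D| ≥ 2|S|: hence all these bounds are equalities and every nonempty part
-- has two vertices.  If two vertices of S dominated a common v, then v, S and the neighbours
-- of the other vertices of S would form a total dominating set of size 2|S| - 1; so S is
-- efficient.  Efficiency makes i ↦ ν i injective on S with values outside S, so S ∪ ν(S) is a
-- paired dominating set of G of size 2|S|.  Its lift is total and paired; it is also
-- restrained and outer-connected, because every vertex (k, b) is adjacent to the vertices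
-- (j, τ j) with τ j ≠ σ j and j a neighbour of k, which avoid the lift and inherit G's walks.

open import Defs
open import Algebra.Properties.CommutativeSemigroup using (interchange)
open import Data.Empty using (⊥-elim)
open import Data.Fin using (Fin; fromℕ<) renaming (zero to fzero; suc to fsuc; _≟_ to _≟ᶠ_)
open import Data.List using (List; []; _∷_; _++_; [_]; length; map; filter; allFin; deduplicate)
open import Data.List.Membership.Propositional using (_∈_; _∉_)
open import Data.List.Membership.Propositional.Properties
open import Data.List.Properties using (length-map; length-++; length-deduplicate; map-cong)
open import Data.List.Relation.Binary.Permutation.Propositional using (_↭_; ↭-trans; prep)
open import Data.List.Relation.Binary.Permutation.Propositional.Properties using (shift; ∈-resp-↭; ↭-length)
open import Data.List.Relation.Binary.Subset.Propositional using (_⊆_)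
import Data.List.Relation.Unary.All as All
open import Data.List.Relation.Unary.AllPairs using (_∷_)
open import Data.List.Relation.Unary.Any using (here; there)
open import Data.List.Relation.Unary.Unique.DecPropositional.Properties using (deduplicate-!)
open import Data.List.Relation.Unary.Unique.Propositional using (Unique)
import Data.List.Relation.Unary.Unique.Propositional.Properties as Unique
open import Data.Nat using (ℕ; zero; suc; _+_; _*_; _≤_; _<_; _<?_; z≤n; s≤s)
open import Data.Nat.ListAction using (sum)
open import Data.Nat.Properties
open import Data.Product using (∃-syntax; _×_; _,_; proj₁; proj₂)
open import Data.Product.Properties using (,-injectiveˡ)
open import Data.Sum using (_⊎_; inj₁; inj₂)
open import Data.Unit using (⊤)
open import Function using (_∘_; id)
open import Relation.Binary.Definitions using (DecidableEquality)
open import Relation.Nullary using (yes; no)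
open import Relation.Binary.PropositionalEquality using (_≡_; _≢_; refl; cong; cong₂)
import Relation.Binary.PropositionalEquality as ≡

∈⇒↭∷ : ∀ {A : Set} {x : A} {xs} → x ∈ xs → ∃[ ys ] xs ↭ x ∷ ys
∈⇒↭∷ x∈ with ys , zs , refl ← ∈-∃++ x∈ = ys ++ zs , shift _ ys zs

∈₂⇒↭∷∷ : ∀ {A : Set} {x y : A} {xs} → x ∈ xs → y ∈ xs → x ≢ y → ∃[ zs ] xs ↭ x ∷ y ∷ zs
∈₂⇒↭∷∷ x∈ y∈ x≢y with ys , xs↭ ← ∈⇒↭∷ x∈ with ∈-resp-↭ xs↭ y∈
... | here y≡x = ⊥-elim (x≢y (≡.sym y≡x))
... | there y∈ys with zs , ys↭ ← ∈⇒↭∷ y∈ys = zs , ↭-trans xs↭ (prep _ ys↭)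

+-≤-rigid : ∀ {a b c d} → a ≤ b → c ≤ d → b + d ≤ a + c → a ≡ b × c ≡ d
+-≤-rigid {a} {b} {c} {d} a≤b c≤d b+d≤a+c =
  ≤-antisym a≤b (+-cancelʳ-≤ d b a (≤-trans b+d≤a+c (+-monoʳ-≤ a c≤d))) ,
  ≤-antisym c≤d (+-cancelˡ-≤ b d c (≤-trans b+d≤a+c (+-monoˡ-≤ c a≤b)))

module _ {A : Set} where

  sum-map-+ : ∀ (f g : A → ℕ) xs → sum (map (λ x → f x + g x) xs) ≡ sum (map f xs) + sum (map g xs)
  sum-map-+ f g [] = refl
  sum-map-+ f g (x ∷ xs) =
    ≡.trans (cong (f x + g x +_) (sum-map-+ f g xs)) (interchange +-commutativeSemigroup (f x) (g x) _ _)

  sum-map-0 : ∀ {f : A → ℕ} xs → (∀ {x} → x ∈ xs → f x ≡ 0) → sum (map f xs) ≡ 0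
  sum-map-0 [] _ = refl
  sum-map-0 (x ∷ xs) f≡0 rewrite f≡0 (here refl) = sum-map-0 xs (f≡0 ∘ there)

  sum-map-mono-≤ : ∀ {f g : A → ℕ} → (∀ x → f x ≤ g x) → ∀ xs → sum (map f xs) ≤ sum (map g xs)
  sum-map-mono-≤ f≤g [] = z≤n
  sum-map-mono-≤ f≤g (x ∷ xs) = +-mono-≤ (f≤g x) (sum-map-mono-≤ f≤g xs)

  sum-map-≤-rigid : ∀ {f g : A → ℕ} → (∀ x → f x ≤ g x) → ∀ xs →
    sum (map g xs) ≤ sum (map f xs) → ∀ {x} → x ∈ xs → f x ≡ g x
  sum-map-≤-rigid f≤g (y ∷ ys) g≤f x∈ with +-≤-rigid (f≤g y) (sum-map-mono-≤ f≤g ys) g≤f | x∈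
  ... | fy≡gy , _ | here refl = fy≡gy
  ... | _ , Σf≡Σg | there x∈ys = sum-map-≤-rigid f≤g ys (≤-reflexive (≡.sym Σf≡Σg)) x∈ys

positiveWeight : ℕ → ℕ
positiveWeight zero = 0
positiveWeight (suc _) = 2

positiveWeight≤ : ∀ {k} → k ≢ 1 → positiveWeight k ≤ k
positiveWeight≤ {zero} _ = z≤n
positiveWeight≤ {suc zero} k≢1 = ⊥-elim (k≢1 refl)
positiveWeight≤ {suc (suc _)} _ = s≤s (s≤s z≤n)

module _ {A : Set} (f : A → ℕ) where

  sum-positiveWeight : ∀ xs → sum (map (positiveWeight ∘ f) xs) ≡ 2 * length (filter (λ x → 0 <? f x) xs)
  sum-positiveWeight [] = refl
  sum-positiveWeight (x ∷ xs) with f x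
  ... | zero = sum-positiveWeight xs
  ... | suc _ = ≡.trans (cong (2 +_) (sum-positiveWeight xs)) (≡.sym (*-suc 2 _))

module Fibres {A K : Set} (_≟_ : DecidableEquality K) (key : A → K) where

  fibre : List A → K → List A
  fibre xs k = filter (λ x → key x ≟ k) xs

  length-fibre-∷ : ∀ x xs k → length (fibre (x ∷ xs) k) ≡ length (fibre [ x ] k) + length (fibre xs k)
  length-fibre-∷ x xs k with key x ≟ k
  ... | yes _ = refl
  ... | no _ = refl

  length-fibre-[]-≢ : ∀ x {k} → key x ≢ k → length (fibre [ x ] k) ≡ 0
  length-fibre-[]-≢ x {k} x≢k with key x ≟ k
  ... | yes x≡k = ⊥-elim (x≢k x≡k)
  ... | no _ = refl

  sum-fibre-∈ : ∀ x {ks} → Unique ks → key x ∈ ks → sum (map (length ∘ fibre [ x ]) ks) ≡ 1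
  sum-fibre-∈ x {k ∷ ks} (k∉ks ∷ ks!) x∈ with key x ≟ k | x∈
  ... | yes refl | _ = cong suc (sum-map-0 ks (length-fibre-[]-≢ x ∘ All.lookup k∉ks))
  ... | no x≢k | here x≡k = ⊥-elim (x≢k x≡k)
  ... | no _ | there x∈ks = sum-fibre-∈ x ks! x∈ks

  sum-length-fibres : ∀ {ks} → Unique ks → (∀ x → key x ∈ ks) → ∀ xs →
    sum (map (length ∘ fibre xs) ks) ≡ length xs
  sum-length-fibres {ks} ks! keys [] = sum-map-0 ks (λ _ → refl)
  sum-length-fibres {ks} ks! keys (x ∷ xs) = begin
    sum (map (length ∘ fibre (x ∷ xs)) ks)
      ≡⟨ cong sum (map-cong (length-fibre-∷ x xs) ks) ⟩
    sum (map (λ k → length (fibre [ x ] k) + length (fibre xs k)) ks)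
      ≡⟨ sum-map-+ (length ∘ fibre [ x ]) (length ∘ fibre xs) ks ⟩
    sum (map (length ∘ fibre [ x ]) ks) + sum (map (length ∘ fibre xs) ks)
      ≡⟨ cong₂ _+_ (sum-fibre-∈ x ks! (keys x)) (sum-length-fibres ks! keys xs) ⟩
    suc (length xs) ∎
    where open ≡.≡-Reasoning

Fin-≢ : ∀ {k} → 2 ≤ k → (i : Fin k) → ∃[ j ] i ≢ j
Fin-≢ (s≤s (s≤s _)) fzero = fsuc fzero , λ ()
Fin-≢ (s≤s (s≤s _)) (fsuc _) = fzero , λ ()

∈⇒0<length : ∀ {A : Set} {x : A} {xs} → x ∈ xs → 0 < length xs
∈⇒0<length (here _) = s≤s z≤n
∈⇒0<length (there _) = s≤s z≤n

module _ {V : Set} (H : Graph V) where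

  adj⇒≢ : ∀ {u v} → Adj H u v → u ≢ v
  adj⇒≢ e refl = irrefl H e

  TotalDominating⇒Dominating : ∀ {S} → TotalDominating H S → Dominating H S
  TotalDominating⇒Dominating t v _ = t v

  TotalDominating-⊆ : ∀ {S S′} → S ⊆ S′ → TotalDominating H S → TotalDominating H S′
  TotalDominating-⊆ S⊆S′ t v with u , u∈ , e ← t v = u , S⊆S′ u∈ , e

  PerfectMatchingOn-⊇⊆ : ∀ {S S′} → S ⊆ S′ → S′ ⊆ S → PerfectMatchingOn H S → PerfectMatchingOn H S′
  PerfectMatchingOn-⊇⊆ S⊆S′ S′⊆S (p , match) = p , λ v v∈ →
    let p∈ , e , pp≡ = match v (S′⊆S v∈) in S⊆S′ p∈ , e , pp≡

  neighbour : Connected H → (∀ v → ∃[ w ] v ≢ w) → ∀ v → ∃[ w ] Adj H v w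
  neighbour conn other v with w , v≢w ← other v with conn v w
  ... | here _ = ⊥-elim (v≢w refl)
  ... | step _ e _ = _ , e

  dominated-twice⇒neighbour : ∀ {u u′ v} → Dominates H u v → Dominates H u′ v → u ≢ u′ →
    Adj H v u ⊎ Adj H u′ u
  dominated-twice⇒neighbour (inj₂ e) _ _ = inj₁ (sym H e)
  dominated-twice⇒neighbour (inj₁ refl) (inj₁ refl) u≢u′ = ⊥-elim (u≢u′ refl)
  dominated-twice⇒neighbour (inj₁ refl) (inj₂ e′) _ = inj₂ e′

module _ {V : Set} (H : Graph V) {D : List V} (minD : MinimumDominating H D) where

  IsMinCard-of-dominating : ∀ {P : List V → Set} {k} → (∀ {X} → P X → Dominating H X) →
    length D ≡ k → ∀ {W} → Unique W → P W → length W ≡ k → IsMinCard H P k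
  IsMinCard-of-dominating P⇒dom |D|≡k {W} W! pW |W|≡k =
    (W , W! , pW , |W|≡k) ,
    λ X X! pX → ≡.subst (_≤ length X) |D|≡k (proj₂ (proj₂ minD) X X! (P⇒dom pX))

module Partners {V : Set} (G : Graph V) (_≟_ : DecidableEquality V)
                (ν : V → V) (ν-adj : ∀ v → Adj G v (ν v)) where

  open import Data.List.Membership.DecPropositional _≟_ using (_∈?_)

  withPartners : List V → List V
  withPartners S = S ++ map ν S

  length-withPartners : ∀ S → length (withPartners S) ≡ 2 * length S
  length-withPartners S = begin
    length (S ++ map ν S)         ≡⟨ length-++ S ⟩
    length S + length (map ν S)   ≡⟨ cong (length S +_) (length-map ν S) ⟩
    length S + length S           ≡⟨ cong (length S +_) (+-identityʳ (length S)) ⟨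
    2 * length S                  ∎
    where open ≡.≡-Reasoning

  withPartners-total : ∀ {S} → Dominating G S → TotalDominating G (withPartners S)
  withPartners-total {S} dom v with v ∈? S
  ... | yes v∈ = ν v , ∈-++⁺ʳ S (∈-map⁺ ν v∈) , sym G (ν-adj v)
  ... | no v∉ with u , u∈ , e ← dom v v∉ = u , ∈-++⁺ˡ u∈ , e

  module _ {S : List V} (eff : EfficientDominating G S) where

    owner : V → V
    owner v = proj₁ (proj₁ (eff v))

    owner-unique : ∀ {u v} → u ∈ S → Dominates G u v → owner v ≡ u
    owner-unique {u} {v} u∈ du =
      let _ , owner∈ , d = proj₁ (eff v) in proj₂ (eff v) _ u owner∈ u∈ d du

    ν∉ : ∀ {u} → u ∈ S → ν u ∉ S
    ν∉ {u} u∈ νu∈ = adj⇒≢ G (ν-adj u)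
      (≡.trans (≡.sym (owner-unique u∈ (inj₂ (ν-adj u)))) (owner-unique νu∈ (inj₁ refl)))

    partner : V → V
    partner v with v ∈? S
    ... | yes _ = ν v
    ... | no _ = owner v

    partner-∈ : ∀ {u} → u ∈ S → partner u ≡ ν u
    partner-∈ {u} u∈ with u ∈? S
    ... | yes _ = refl
    ... | no u∉ = ⊥-elim (u∉ u∈)

    partner-ν : ∀ {u} → u ∈ S → partner (ν u) ≡ u
    partner-ν {u} u∈ with ν u ∈? S
    ... | yes νu∈ = ⊥-elim (ν∉ u∈ νu∈)
    ... | no _ = owner-unique u∈ (inj₂ (ν-adj u))

    withPartners-matching : PerfectMatchingOn G (withPartners S)
    withPartners-matching = partner , matched
      where
        matched : ∀ v → v ∈ withPartners S →
          (partner v ∈ withPartners S) × Adj G v (partner v) × (partner (partner v) ≡ v)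
        matched v v∈ with ∈-++⁻ S v∈
        ... | inj₁ u∈ rewrite partner-∈ u∈ | partner-ν u∈ =
          ∈-++⁺ʳ S (∈-map⁺ ν u∈) , ν-adj v , refl
        ... | inj₂ νu∈ with u , u∈ , refl ← ∈-map⁻ ν νu∈ rewrite partner-ν u∈ | partner-∈ u∈ =
          ∈-++⁺ˡ u∈ , sym G (ν-adj u) , refl

  dominated-twice⇒short-total : ∀ {S u u′ v} → Dominating G S → u ∈ S → u′ ∈ S → u ≢ u′ →
    Dominates G u v → Dominates G u′ v →
    ∃[ T ] TotalDominating G T × length T < 2 * length S
  dominated-twice⇒short-total {S} {u} {u′} {v} dom u∈ u′∈ u≢u′ du du′
    with zs , S↭ ← ∈₂⇒↭∷∷ u∈ u′∈ u≢u′ = T , total , shorter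
    where
      T : List V
      T = v ∷ S ++ map ν zs

      neighbour-of : ∀ {w w′} → w′ ∈ S → Dominates G w v → Dominates G w′ v → w ≢ w′ → ∃[ x ] x ∈ T × Adj G x w
      neighbour-of w′∈ dw dw′ w≢w′ with dominated-twice⇒neighbour G dw dw′ w≢w′
      ... | inj₁ e = v , here refl , e
      ... | inj₂ e = _ , there (∈-++⁺ˡ w′∈) , e

      total : TotalDominating G T
      total w with w ∈? S
      ... | no w∉ with x , x∈ , e ← dom w w∉ = x , there (∈-++⁺ˡ x∈) , e
      ... | yes w∈ with ∈-resp-↭ S↭ w∈
      ...   | here refl = neighbour-of u′∈ du du′ u≢u′
      ...   | there (here refl) = neighbour-of u∈ du′ du (u≢u′ ∘ ≡.sym)
      ...   | there (there w∈zs) = ν w , there (∈-++⁺ʳ S (∈-map⁺ ν w∈zs)) , sym G (ν-adj w)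

      shorter : length T < 2 * length S
      shorter = ≤-reflexive (begin
        suc (suc (length (S ++ map ν zs)))      ≡⟨ cong (suc ∘ suc) (length-++ S) ⟩
        suc (suc (length S + length (map ν zs))) ≡⟨ cong (λ k → suc (suc (length S + k))) (length-map ν zs) ⟩
        suc (suc (length S + length zs))         ≡⟨ cong suc (+-suc (length S) (length zs)) ⟨
        suc (length S + suc (length zs))         ≡⟨ +-suc (length S) (suc (length zs)) ⟨
        length S + suc (suc (length zs))        ≡⟨ cong (length S +_) (↭-length S↭) ⟨
        length S + length S                      ≡⟨ cong (length S +_) (+-identityʳ (length S)) ⟨
        2 * length S                             ∎)
        where open ≡.≡-Reasoning

  tight⇒efficient : ∀ {S} → Dominating G S →
    (∀ T → TotalDominating G T → 2 * length S ≤ length T) → EfficientDominating G S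
  tight⇒efficient {S} dom tight v = dominator , unique
    where
      dominator : ∃[ u ] u ∈ S × Dominates G u v
      dominator with v ∈? S
      ... | yes v∈ = v , v∈ , inj₁ refl
      ... | no v∉ with u , u∈ , e ← dom v v∉ = u , u∈ , inj₂ e

      unique : ∀ u u′ → u ∈ S → u′ ∈ S → Dominates G u v → Dominates G u′ v → u ≡ u′
      unique u u′ u∈ u′∈ du du′ with u ≟ u′
      ... | yes u≡u′ = u≡u′
      ... | no u≢u′ with T , total , shorter ← dominated-twice⇒short-total dom u∈ u′∈ u≢u′ du du′ =
        ⊥-elim (<⇒≱ shorter (tight T total))

module Lex {n : ℕ} (G : Graph (Fin n)) (m : Fin n → ℕ) (F : (i : Fin n) → Graph (Fin (m i))) where

  H : Graph (LexV G m F)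
  H = LexProduct G m F

  -- part G m F D is definitionally fibre D, so the counting lemmas apply to it.
  open Fibres _≟ᶠ_ (proj₁ {B = Fin ∘ m})

  Section : Set
  Section = (i : Fin n) → Fin (m i)

  lift : Section → List (Fin n) → List (LexV G m F)
  lift σ = map (λ i → i , σ i)

  lift-unique : ∀ σ {T} → Unique T → Unique (lift σ T)
  lift-unique σ = Unique.map⁺ ,-injectiveˡ

  lift-total : ∀ σ {T} → TotalDominating G T → TotalDominating H (lift σ T)
  lift-total σ t (k , _) with i , i∈ , e ← t k = (i , σ i) , ∈-map⁺ _ i∈ , across (adj⇒≢ G e) e

  lift-matching : ∀ σ {T} → PerfectMatchingOn G T → PerfectMatchingOn H (lift σ T)
  lift-matching σ {T} (π , match) = π′ , matched
    where
      π′ : LexV G m F → LexV G m F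
      π′ (k , _) = π k , σ (π k)

      matched : ∀ v → v ∈ lift σ T → (π′ v ∈ lift σ T) × Adj H v (π′ v) × (π′ (π′ v) ≡ v)
      matched v v∈ with i , i∈ , refl ← ∈-map⁻ (λ i → i , σ i) v∈ with π∈ , e , ππ≡ ← match i i∈ =
        ∈-map⁺ _ π∈ , across (adj⇒≢ G e) e , cong (λ j → j , σ j) ππ≡

  module _ (σ τ : Section) (σ≢τ : ∀ i → σ i ≢ τ i) where

    ∉lift : ∀ {k T} → (k , τ k) ∉ lift σ T
    ∉lift {k} k∈ with i , _ , eq ← ∈-map⁻ _ k∈ =
      σ≢τ k (≡.subst (λ (j , a) → σ j ≡ a) (≡.sym eq) refl)

    lift-restrained : ∀ {T} → (∀ k → ∃[ j ] Adj G k j) → RestrainedCond H (lift σ T)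
    lift-restrained nb (k , _) _ with j , e ← nb k = (j , τ j) , ∉lift , across (adj⇒≢ G (sym G e)) (sym G e)

    lift-walk : ∀ {T k j l b c} → (k , b) ∉ lift σ T → (l , c) ∉ lift σ T →
      Adj G k j → Reach G (λ _ → ⊤) j l → Reach H (_∉ lift σ T) (k , b) (l , c)
    lift-walk kb∉ lc∉ e (here _) = step kb∉ (across (adj⇒≢ G e) e) (here lc∉)
    lift-walk kb∉ lc∉ e (step _ e′ r) = step kb∉ (across (adj⇒≢ G e) e) (lift-walk ∉lift lc∉ e′ r)

    lift-outerConnected : ∀ {T} → Connected G → (∀ k → ∃[ j ] Adj G k j) → OuterConnectedCond H (lift σ T)
    lift-outerConnected conn nb (k , b) (l , c) kb∉ lc∉ with j , e ← nb k = lift-walk kb∉ lc∉ e (conn j l)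

  ∈⇒∈support : ∀ {D x} → x ∈ D → proj₁ x ∈ support G m F D
  ∈⇒∈support {D} {x} x∈ = ∈-filter⁺ (λ i → 0 <? length (part G m F D i)) (∈-allFin (proj₁ x))
    (∈⇒0<length (∈-filter⁺ (λ y → proj₁ y ≟ᶠ proj₁ x) x∈ refl))

  support-dominating : Section → ∀ {D} → Dominating H D → Dominating G (support G m F D)
  support-dominating σ dom v v∉ with dom (v , σ v) (v∉ ∘ ∈⇒∈support)
  ... | _ , u∈ , inside _ = ⊥-elim (v∉ (∈⇒∈support u∈))
  ... | (i , _) , u∈ , across _ e = i , ∈⇒∈support u∈ , e

  minimum≤total : Section → ∀ {D} → MinimumDominating H D →
    ∀ T → TotalDominating G T → length D ≤ length T
  minimum≤total σ {D} (_ , _ , minimum) T total = begin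
    length D                        ≤⟨ minimum (lift σ T′) (lift-unique σ (deduplicate-! _≟ᶠ_ T))
                                          (TotalDominating⇒Dominating H (lift-total σ total′)) ⟩
    length (lift σ T′)              ≡⟨ length-map _ T′ ⟩
    length T′                       ≤⟨ length-deduplicate _≟ᶠ_ T ⟩
    length T                        ∎
    where
      open ≤-Reasoning
      T′ : List (Fin n)
      T′ = deduplicate _≟ᶠ_ T
      total′ : TotalDominating G T′
      total′ = TotalDominating-⊆ G (∈-deduplicate⁺ _≟ᶠ_) total

  module _ (D : List (LexV G m F)) (no-singleton : ∀ i → length (part G m F D i) ≢ 1) where

    private
      size : Fin n → ℕ
      size i = length (part G m F D i)

      weight≤size : ∀ i → positiveWeight (size i) ≤ size i
      weight≤size i = positiveWeight≤ (no-singleton i)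

    double-support≤ : 2 * length (support G m F D) ≤ length D
    double-support≤ = begin
      2 * length (support G m F D)                ≡⟨ sum-positiveWeight size (allFin n) ⟨
      sum (map (positiveWeight ∘ size) (allFin n)) ≤⟨ sum-map-mono-≤ weight≤size (allFin n) ⟩
      sum (map size (allFin n))                    ≡⟨ sum-length-fibres (Unique.allFin⁺ n) (∈-allFin ∘ proj₁) D ⟩
      length D                                     ∎
      where open ≤-Reasoning

    parts-of-tight-support : length D ≤ 2 * length (support G m F D) →
      ∀ i → part G m F D i ≢ [] → length (part G m F D i) ≡ 2
    parts-of-tight-support tight i nonempty
      with part G m F D i | sum-map-≤-rigid weight≤size (allFin n) sizes≤weights (∈-allFin i)
      where
        sizes≤weights : sum (map size (allFin n)) ≤ sum (map (positiveWeight ∘ size) (allFin n))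
        sizes≤weights = begin
          sum (map size (allFin n))                    ≡⟨ sum-length-fibres (Unique.allFin⁺ n) (∈-allFin ∘ proj₁) D ⟩
          length D                                     ≤⟨ tight ⟩
          2 * length (support G m F D)                ≡⟨ sum-positiveWeight size (allFin n) ⟨
          sum (map (positiveWeight ∘ size) (allFin n)) ∎
          where open ≤-Reasoning
    ... | [] | _ = ⊥-elim (nonempty refl)
    ... | _ ∷ [] | ()
    ... | _ ∷ _ ∷ _ | weight≡size = ≡.sym weight≡size

  module NoSingletonParts (σ : Section) (ν : Fin n → Fin n) (ν-adj : ∀ i → Adj G i (ν i))
    {D : List (LexV G m F)} (minD : MinimumDominating H D)
    (no-singleton : ∀ i → length (part G m F D i) ≢ 1) where

    open Partners G _≟ᶠ_ ν ν-adj

    S : List (Fin n)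
    S = support G m F D

    support-dom : Dominating G S
    support-dom = support-dominating σ (proj₁ (proj₂ minD))

    minimum≤double-dominating : ∀ {S′} → Dominating G S′ → length D ≤ 2 * length S′
    minimum≤double-dominating {S′} dom = ≤-trans (minimum≤total σ minD _ (withPartners-total dom))
                                                (≤-reflexive (length-withPartners S′))

    length≡double-support : length D ≡ 2 * length S
    length≡double-support = ≤-antisym (minimum≤double-dominating support-dom) (double-support≤ D no-singleton)

    double-support≤total : ∀ T → TotalDominating G T → 2 * length S ≤ length T
    double-support≤total T total = ≡.subst (_≤ length T) length≡double-support (minimum≤total σ minD T total)

    support-efficient : EfficientDominating G S
    support-efficient = tight⇒efficient support-dom double-support≤total

    support-minimum : IsMinCard G (Dominating G) (length S)
    support-minimum =
      (S , Unique.filter⁺ (λ i → 0 <? length (part G m F D i)) (Unique.allFin⁺ n) , support-dom , refl) ,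
      λ S′ _ dom → *-cancelˡ-≤ 2 (≡.subst (_≤ _) length≡double-support (minimum≤double-dominating dom))

    P : List (Fin n)
    P = deduplicate _≟ᶠ_ (withPartners S)

    P-unique : Unique P
    P-unique = deduplicate-! _≟ᶠ_ (withPartners S)

    P-total : TotalDominating G P
    P-total = TotalDominating-⊆ G (∈-deduplicate⁺ _≟ᶠ_) (withPartners-total support-dom)

    P-matching : PerfectMatchingOn G P
    P-matching = PerfectMatchingOn-⊇⊆ G (∈-deduplicate⁺ _≟ᶠ_) (∈-deduplicate⁻ _≟ᶠ_ _)
                   (withPartners-matching support-efficient)

    length-P : length P ≡ 2 * length S
    length-P = ≤-antisym (≤-trans (length-deduplicate _≟ᶠ_ (withPartners S)) (≤-reflexive (length-withPartners S)))
                         (double-support≤total P P-total)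

    P-minimumTotal : IsMinCard G (TotalDominating G) (2 * length S)
    P-minimumTotal = (P , P-unique , P-total , length-P) , λ T _ total → double-support≤total T total

theorem2p10 : (n : ℕ) → 2 ≤ n → (G : Graph (Fin n)) → Connected G →
    (m : Fin n → ℕ) → (F : (i : Fin n) → Graph (Fin (m i))) →
    (D : List (LexV G m F)) → MinimumDominating (LexProduct G m F) D →
    (∀ i → 2 ≤ m i) → (∀ i → length (part G m F D i) ≢ 1) →
    (∀ i → part G m F D i ≢ [] → length (part G m F D i) ≡ 2)
    × EfficientDominating G (support G m F D)
    × ∃[ g ] ( IsMinCard G (Dominating G) g
             × IsMinCard G (TotalDominating G) (2 * g)
             × IsMinCard (LexProduct G m F) (Dominating (LexProduct G m F)) (2 * g)
             × IsMinCard (LexProduct G m F) (RestrainedDominating (LexProduct G m F)) (2 * g)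
             × IsMinCard (LexProduct G m F) (TotalDominating (LexProduct G m F)) (2 * g)
             × IsMinCard (LexProduct G m F) (TotalRestrainedDominating (LexProduct G m F)) (2 * g)
             × IsMinCard (LexProduct G m F) (OuterConnectedDominating (LexProduct G m F)) (2 * g)
             × IsMinCard (LexProduct G m F) (TotalOuterConnectedDominating (LexProduct G m F)) (2 * g)
             × IsMinCard (LexProduct G m F) (PairedDominating (LexProduct G m F)) (2 * g))
theorem2p10 n n≥2 G conn m F D minD m≥2 no-singleton =
  parts-of-tight-support D no-singleton (≤-reflexive length≡double-support) ,
  support-efficient , length S , support-minimum , P-minimumTotal ,
  lexMinCard id (TotalDominating⇒Dominating H W-total) ,
  lexMinCard proj₁ (TotalDominating⇒Dominating H W-total , W-restrained) ,
  lexMinCard (TotalDominating⇒Dominating H) W-total ,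
  lexMinCard (TotalDominating⇒Dominating H ∘ proj₁) (W-total , W-restrained) ,
  lexMinCard proj₁ (TotalDominating⇒Dominating H W-total , W-outerConnected) ,
  lexMinCard (TotalDominating⇒Dominating H ∘ proj₁) (W-total , W-outerConnected) ,
  lexMinCard proj₁ (TotalDominating⇒Dominating H W-total , lift-matching σ P-matching)
  where
    open Lex G m F

    σ τ : Section
    σ i = fromℕ< (m≥2 i)
    τ i = proj₁ (Fin-≢ (m≥2 i) (σ i))

    σ≢τ : ∀ i → σ i ≢ τ i
    σ≢τ i = proj₂ (Fin-≢ (m≥2 i) (σ i))

    nb : ∀ i → ∃[ j ] Adj G i j
    nb = neighbour G conn (Fin-≢ n≥2)

    open NoSingletonParts σ (proj₁ ∘ nb) (proj₂ ∘ nb) minD no-singleton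

    W : List (LexV G m F)
    W = lift σ P

    W-total : TotalDominating H W
    W-total = lift-total σ P-total

    W-restrained : RestrainedCond H W
    W-restrained = lift-restrained σ τ σ≢τ nb

    W-outerConnected : OuterConnectedCond H W
    W-outerConnected = lift-outerConnected σ τ σ≢τ conn nb

    lexMinCard : ∀ {Q : List (LexV G m F) → Set} → (∀ {X} → Q X → Dominating H X) → Q W →
      IsMinCard H Q (2 * length S)
    lexMinCard Q⇒dom qW = IsMinCard-of-dominating H minD Q⇒dom length≡double-support
                            (lift-unique σ P-unique) qW (≡.trans (length-map _ P) length-P)
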